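{- Let $A=\{(a_1,b_1),(a_2,b_2),\dots,(a_m,b_m)\}$ where the $a_i,b_i$ are non-negative integers. Let $a$ be the smallest non-zero $a_i$, $a'$ the largest $a_i$, $b$ the smallest non-zero $b_i$, $b'$ the largest $b_i$, and $N=\max\{2a'^2,2b'^2\}$. Suppose $a$ and $a'$ are coprime, $b$ and $b'$ are coprime, and $$\{(0,0),(a,0),(0,b),(a',0),(0,b'),(a,b),(a,b'),(a',b),(a',b')\}\subset A.$$ Then there exist constants $\ell,\ell_1,\ell_2$ such that for all $k\geq N$, $$|kA|=k^2a'b'-\ell-\ell_1a'k-\ell_2b'k.$$
   Context: $kA=\{u_1+\cdots+u_k:u_i\in A\}$ denotes the $k$-fold sumset of $A$. -}

module Defs where

open import Data.Nat using (ℕ; zero; suc; _+_; _≟_)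
open import Data.Product using (_×_; _,_)
open import Data.Product.Properties using (≡-dec)
open import Data.List using (List; []; _∷_; map; concatMap; length; deduplicate)

Pt : Set
Pt = ℕ × ℕ

_+ₚ_ : Pt → Pt → Pt
(x , y) +ₚ (u , v) = (x + u , y + v)

sumset : ℕ → List Pt → List Pt
sumset zero    A = (0 , 0) ∷ []
sumset (suc k) A = concatMap (λ p → map (p +ₚ_) A) (sumset k A)

_≟ₚ_ : (p q : Pt) → _
_≟ₚ_ = ≡-dec _≟_ _≟_

card-sumset : ℕ → List Pt → ℕ
card-sumset k A = length (deduplicate _≟ₚ_ (sumset k A))

{-# OPTIONS --safe #-}
-- kA lies in the box [0, k a'] × [0, k b'].  Near each corner of the box, kA agrees with the monoid
-- generated by A seen from that corner (A reflected in the corresponding axes): by the Frobenius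
-- argument for the coprime pairs (a, a') and (b, b'), a point that is a sum of elements of A near
-- that corner is a sum of at most k of them, and (0, 0) ∈ A pads such a sum to exactly k terms.
-- The indicator of each such monoid is constant in x for x ≥ Q a' and in y for y ≥ Q b', where
-- Q = max(a'², b'²), and equals 1 at (Q a', Q b'); so its count over a rectangle of size
-- (Q a' + dX) × (Q b' + dY) is C + dY G + dX H + dX dY.  The four corners, with
-- dX = 1 + (k - 2Q) a' and dY = 1 + (k - 2Q) b' for the near ones and 0 for the far ones,
-- give a quadratic polynomial in k with leading coefficient a' b'.
module Submission where

open import Defs
open import Data.Nat
open import Data.Nat.Properties
open import Data.Nat.ListAction using (sum)
open import Data.Nat.ListAction.Properties using (sum-++)
open import Data.Product using (Σ; ∃; ∃₂; _×_; _,_; proj₁; proj₂; swap)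
open import Data.List using (List; []; _∷_; map; length; _++_; replicate; filter; deduplicate)
open import Data.List.Properties using (length-++; length-map; length-replicate; map-∘; filter-++)
open import Data.List.Relation.Unary.All as All using (All; []; _∷_)
import Data.List.Relation.Unary.All.Properties as All
open import Data.List.Relation.Unary.Any using (here; there)
open import Data.List.Membership.Propositional using (_∈_; find; lose)
open import Data.List.Membership.Propositional.Properties
  using ( ∈-map⁺; ∈-map⁻; ∈-concatMap⁺; ∈-concatMap⁻; ∈-++⁻; ∈-++⁺ˡ; ∈-++⁺ʳ
        ; ∈-filter⁺; ∈-filter⁻; ∈-deduplicate⁺; ∈-deduplicate⁻)
open import Data.List.Membership.Propositional.Properties.WithK using (unique∧set⇒bag)
open import Data.List.Membership.DecPropositional _≟ₚ_ using (_∈?_)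
open import Data.List.Relation.Unary.Unique.Propositional using (Unique)
import Data.List.Relation.Unary.Unique.Propositional.Properties as Unique
open import Data.List.Relation.Unary.Unique.DecPropositional.Properties _≟ₚ_ using (deduplicate-!)
open import Data.List.Relation.Unary.AllPairs using ([]; _∷_)
open import Data.List.Relation.Binary.BagAndSetEquality using (∼bag⇒↭)
open import Data.List.Relation.Binary.Permutation.Propositional.Properties using (↭-length)
open import Function.Bundles using (mk⇔)
open import Relation.Unary using (Decidable)
open import Algebra.Properties.CommutativeSemigroup +-commutativeSemigroup using (interchange)
open import Data.Nat.DivMod using (_%_; _/_; m%n<n; m≡m%n+[m/n]*n)
open import Data.Nat.Coprimality using (Coprime; coprime-Bézout)
open import Data.Nat.Divisibility using (_∣_; ∣m+n∣m⇒∣n)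
open import Data.Nat.GCD using (module Bézout)
open import Data.Nat.Tactic.RingSolver using (solve-∀)
open import Data.Sum using (inj₁; inj₂)
open import Function using (_∘_)
open import Relation.Nullary using (Dec; yes; no; contradiction)
open import Relation.Binary.PropositionalEquality

sumₚ : List Pt → Pt
sumₚ []       = (0 , 0)
sumₚ (t ∷ ts) = t +ₚ sumₚ ts

+ₚ-comm : ∀ s t → s +ₚ t ≡ t +ₚ s
+ₚ-comm (x , y) (u , v) = cong₂ _,_ (+-comm x u) (+-comm y v)

+ₚ-assoc : ∀ r s t → (r +ₚ s) +ₚ t ≡ r +ₚ (s +ₚ t)
+ₚ-assoc (x , y) (u , v) (w , z) = cong₂ _,_ (+-assoc x u w) (+-assoc y v z)

+ₚ-identityʳ : ∀ s → s +ₚ (0 , 0) ≡ s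
+ₚ-identityʳ (x , y) = cong₂ _,_ (+-identityʳ x) (+-identityʳ y)

sumₚ-++ : ∀ ss ts → sumₚ (ss ++ ts) ≡ sumₚ ss +ₚ sumₚ ts
sumₚ-++ []       ts = refl
sumₚ-++ (s ∷ ss) ts = trans (cong (s +ₚ_) (sumₚ-++ ss ts)) (sym (+ₚ-assoc s _ _))

sumₚ-swap : ∀ ts → sumₚ (map swap ts) ≡ swap (sumₚ ts)
sumₚ-swap []       = refl
sumₚ-swap (t ∷ ts) = cong (swap t +ₚ_) (sumₚ-swap ts)

sumₚ-replicate-origin : ∀ n → sumₚ (replicate n (0 , 0)) ≡ (0 , 0)
sumₚ-replicate-origin zero    = refl
sumₚ-replicate-origin (suc n) = sumₚ-replicate-origin n

∈-map-elim : ∀ {f : Pt → Pt} {B} (P : Pt → Set) → (∀ {s} → s ∈ B → P (f s)) → ∀ {t} → t ∈ map f B → P t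
∈-map-elim _ h = All.lookup (All.map⁺ (All.tabulate h))

row : List ℕ → List Pt
row = map (_, 0)

column : List ℕ → List Pt
column = map (0 ,_)

sumₚ-row : ∀ us → sumₚ (row us) ≡ (sum us , 0)
sumₚ-row []       = refl
sumₚ-row (u ∷ us) = cong ((u , 0) +ₚ_) (sumₚ-row us)

sumₚ-column : ∀ vs → sumₚ (column vs) ≡ (0 , sum vs)
sumₚ-column []       = refl
sumₚ-column (v ∷ vs) = cong ((0 , v) +ₚ_) (sumₚ-column vs)

pairUp : List ℕ → List ℕ → List Pt
pairUp []       vs       = column vs
pairUp (u ∷ us) []       = row (u ∷ us)
pairUp (u ∷ us) (v ∷ vs) = (u , v) ∷ pairUp us vs

sumₚ-pairUp : ∀ us vs → sumₚ (pairUp us vs) ≡ (sum us , sum vs)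
sumₚ-pairUp []       vs       = sumₚ-column vs
sumₚ-pairUp (u ∷ us) []       = sumₚ-row (u ∷ us)
sumₚ-pairUp (u ∷ us) (v ∷ vs) = cong ((u , v) +ₚ_) (sumₚ-pairUp us vs)

length-pairUp : ∀ us vs {k} → length us ≤ k → length vs ≤ k → length (pairUp us vs) ≤ k
length-pairUp []       vs       _         h         = ≤-trans (≤-reflexive (length-map _ vs)) h
length-pairUp (u ∷ us) []       h         _         = ≤-trans (≤-reflexive (length-map _ (u ∷ us))) h
length-pairUp (u ∷ us) (v ∷ vs) (s≤s h₁) (s≤s h₂) = s≤s (length-pairUp us vs h₁ h₂)

All-pairUp : ∀ {P Q : ℕ → Set} {R : Pt → Set} → P 0 → Q 0 → (∀ {u v} → P u → Q v → R (u , v)) →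
             ∀ {us vs} → All P us → All Q vs → All R (pairUp us vs)
All-pairUp p0 q0 r {[]}     {vs}     _         qs        = All.map⁺ (All.map (r p0) qs)
All-pairUp p0 q0 r {u ∷ us} {[]}     ps        _         = All.map⁺ (All.map (λ pu → r pu q0) ps)
All-pairUp p0 q0 r {u ∷ us} {v ∷ vs} (pu ∷ ps) (qv ∷ qs) = r pu qv ∷ All-pairUp p0 q0 r ps qs

record Additive (f : Pt → ℕ) : Set where
  field
    f-origin : f (0 , 0) ≡ 0
    f-+      : ∀ s t → f (s +ₚ t) ≡ f s + f t

proj₁-additive : Additive proj₁
proj₁-additive = record { f-origin = refl ; f-+ = λ _ _ → refl }

proj₂-additive : Additive proj₂
proj₂-additive = record { f-origin = refl ; f-+ = λ _ _ → refl }

weight : Pt → ℕ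
weight (x , y) = x + y

weight-additive : Additive weight
weight-additive = record { f-origin = refl ; f-+ = λ (x , y) (u , v) → interchange x u y v }

module _ {f : Pt → ℕ} (additive : Additive f) where
  open Additive additive

  length≤sumₚ : ∀ {ts} → All (λ t → 1 ≤ f t) ts → length ts ≤ f (sumₚ ts)
  length≤sumₚ []                = z≤n
  length≤sumₚ {t ∷ ts} (h ∷ hs) = ≤-trans (+-mono-≤ h (length≤sumₚ hs)) (≤-reflexive (sym (f-+ t (sumₚ ts))))

  sumₚ-zero : ∀ {ts} → All (λ t → f t ≡ 0) ts → f (sumₚ ts) ≡ 0
  sumₚ-zero []                = f-origin
  sumₚ-zero {t ∷ ts} (h ∷ hs) = trans (f-+ t (sumₚ ts)) (cong₂ _+_ h (sumₚ-zero hs))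

  sumₚ-≤ : ∀ {c ts} → All (λ t → f t ≤ c) ts → f (sumₚ ts) ≤ length ts * c
  sumₚ-≤ []                = ≤-reflexive f-origin
  sumₚ-≤ {ts = t ∷ ts} (h ∷ hs) = ≤-trans (≤-reflexive (f-+ t (sumₚ ts))) (+-mono-≤ h (sumₚ-≤ hs))

splitByZero : (f : Pt → ℕ) (ts : List Pt) → Σ (List Pt) λ xs → Σ (List Pt) λ zs →
  All (λ t → 1 ≤ f t) xs × All (λ t → f t ≡ 0) zs × sumₚ ts ≡ sumₚ xs +ₚ sumₚ zs ×
  (∀ {P : Pt → Set} → All P ts → All P xs × All P zs)
splitByZero f [] = [] , [] , [] , [] , refl , λ _ → [] , []
splitByZero f (t ∷ ts) with splitByZero f ts | f t in ft
... | xs , zs , pos , nul , eq , sub | zero =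
  xs , t ∷ zs , pos , ft ∷ nul , sum-eq , λ { (pt ∷ pts) → proj₁ (sub pts) , pt ∷ proj₂ (sub pts) }
  where
  sum-eq : t +ₚ sumₚ ts ≡ sumₚ xs +ₚ (t +ₚ sumₚ zs)
  sum-eq = begin
    t +ₚ sumₚ ts                ≡⟨ cong (t +ₚ_) eq ⟩
    t +ₚ (sumₚ xs +ₚ sumₚ zs)   ≡⟨ sym (+ₚ-assoc t _ _) ⟩
    (t +ₚ sumₚ xs) +ₚ sumₚ zs   ≡⟨ cong (_+ₚ sumₚ zs) (+ₚ-comm t _) ⟩
    (sumₚ xs +ₚ t) +ₚ sumₚ zs   ≡⟨ +ₚ-assoc (sumₚ xs) t _ ⟩
    sumₚ xs +ₚ (t +ₚ sumₚ zs)   ∎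
    where open ≡-Reasoning
... | xs , zs , pos , nul , eq , sub | suc _ =
  t ∷ xs , zs , subst (1 ≤_) (sym ft) (s≤s z≤n) ∷ pos , nul ,
  trans (cong (t +ₚ_) eq) (sym (+ₚ-assoc t _ _)) , λ { (pt ∷ pts) → pt ∷ proj₁ (sub pts) , proj₂ (sub pts) }

SumOfAtMost : List Pt → ℕ → Pt → Set
SumOfAtMost B k r = ∃ λ ts → All (_∈ B) ts × length ts ≤ k × sumₚ ts ≡ r

SumOf : List Pt → Pt → Set
SumOf B r = ∃ λ k → SumOfAtMost B k r

SumOfLength : List Pt → ℕ → Pt → Set
SumOfLength B k r = ∃ λ ts → All (_∈ B) ts × length ts ≡ k × sumₚ ts ≡ r

∈sumset⇒sumOfLength : ∀ B k {r} → r ∈ sumset k B → SumOfLength B k r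
∈sumset⇒sumOfLength B zero    (here refl) = [] , [] , refl , refl
∈sumset⇒sumOfLength B (suc k) r∈
  with find (∈-concatMap⁻ (λ s → map (s +ₚ_) B) {xs = sumset k B} r∈)
... | s , s∈ , r∈s+B with ∈-map⁻ (s +ₚ_) r∈s+B
... | t , t∈B , refl with ∈sumset⇒sumOfLength B k s∈
... | ts , ts⊆B , refl , refl = t ∷ ts , t∈B ∷ ts⊆B , refl , +ₚ-comm t (sumₚ ts)

sumₚ∈sumset : ∀ {B ts} → All (_∈ B) ts → sumₚ ts ∈ sumset (length ts) B
sumₚ∈sumset []                     = here refl
sumₚ∈sumset {B} {t ∷ ts} (t∈ ∷ ts⊆) =
  ∈-concatMap⁺ (λ s → map (s +ₚ_) B) {xs = sumset (length ts) B}
    (lose (sumₚ∈sumset ts⊆) (subst (_∈ map (sumₚ ts +ₚ_) B) (+ₚ-comm (sumₚ ts) t) (∈-map⁺ (sumₚ ts +ₚ_) t∈)))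

∈sumset⇒sumOf : ∀ {B} k {r} → r ∈ sumset k B → SumOf B r
∈sumset⇒sumOf {B} k r∈ with ∈sumset⇒sumOfLength B k r∈
... | ts , ts⊆B , len , eq = k , ts , ts⊆B , ≤-reflexive len , eq

sumOfAtMost⇒∈sumset : ∀ {B k r} → (0 , 0) ∈ B → SumOfAtMost B k r → r ∈ sumset k B
sumOfAtMost⇒∈sumset {B} {k} {r} o∈B (ts , ts⊆B , len≤ , eq) =
  subst₂ (λ n s → s ∈ sumset n B) length-padded sum-padded (sumₚ∈sumset (All.++⁺ ts⊆B (All.replicate⁺ _ o∈B)))
  where
  padding = replicate (k ∸ length ts) (0 , 0)
  length-padded : length (ts ++ padding) ≡ k
  length-padded = trans (length-++ ts) (trans (cong (length ts +_) (length-replicate (k ∸ length ts))) (m+[n∸m]≡n len≤))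
  sum-padded : sumₚ (ts ++ padding) ≡ r
  sum-padded = trans (sumₚ-++ ts padding)
    (trans (cong (sumₚ ts +ₚ_) (sumₚ-replicate-origin (k ∸ length ts))) (trans (+ₚ-identityʳ _) eq))

sumOfAtMost-++ : ∀ {B k l r s} → SumOfAtMost B k r → SumOfAtMost B l s → SumOfAtMost B (k + l) (r +ₚ s)
sumOfAtMost-++ (ts , ts⊆B , ts≤ , refl) (us , us⊆B , us≤ , refl) =
  ts ++ us , All.++⁺ ts⊆B us⊆B , ≤-trans (≤-reflexive (length-++ ts)) (+-mono-≤ ts≤ us≤) , sumₚ-++ ts us

sumOfAtMost-++-snd : ∀ {B k l x y z} → SumOfAtMost B k (x , y) → SumOfAtMost B l (0 , z) → SumOfAtMost B (k + l) (x , y + z)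
sumOfAtMost-++-snd {B} {k} {l} {x} {y} {z} r s = subst (SumOfAtMost B (k + l)) (cong (_, y + z) (+-identityʳ x)) (sumOfAtMost-++ r s)

sumOfAtMost-++-fst : ∀ {B k l x y z} → SumOfAtMost B k (x , y) → SumOfAtMost B l (z , 0) → SumOfAtMost B (k + l) (x + z , y)
sumOfAtMost-++-fst {B} {k} {l} {x} {y} {z} r s = subst (SumOfAtMost B (k + l)) (cong (x + z ,_) (+-identityʳ y)) (sumOfAtMost-++ r s)

sumOfAtMost-weaken : ∀ {B k l r} → k ≤ l → SumOfAtMost B k r → SumOfAtMost B l r
sumOfAtMost-weaken k≤l (ts , ts⊆B , ts≤ , eq) = ts , ts⊆B , ≤-trans ts≤ k≤l , eq

sumOfAtMost-swap : ∀ {B k r} → SumOfAtMost B k r → SumOfAtMost (map swap B) k (swap r)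
sumOfAtMost-swap (ts , ts⊆B , ts≤ , refl) =
  map swap ts , All.map⁺ (All.map (∈-map⁺ swap) ts⊆B) , ≤-trans (≤-reflexive (length-map swap ts)) ts≤ , sumₚ-swap ts

sumOfAtMost-unswap : ∀ {B k r} → SumOfAtMost (map swap B) k r → SumOfAtMost B k (swap r)
sumOfAtMost-unswap {B} (ts , ts⊆B , ts≤ , refl) =
  map swap ts , All.map⁺ (All.map (∈-map-elim (λ t → swap t ∈ B) (λ s∈B → s∈B)) ts⊆B) ,
  ≤-trans (≤-reflexive (length-map swap ts)) ts≤ , sumₚ-swap ts

dropOrigin : ∀ {B r} → SumOf B r → SumOfAtMost B (weight r) r
dropOrigin {B} {r} (_ , ts , ts⊆B , _ , eq) with splitByZero weight ts
... | xs , zs , pos , nul , split , sub = xs , proj₁ (sub ts⊆B) , len≤ , sum-xs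
  where
  zs-origin : sumₚ zs ≡ (0 , 0)
  zs-origin = cong₂ _,_ (sumₚ-zero proj₁-additive (All.map (λ {t} → m+n≡0⇒m≡0 (proj₁ t)) nul))
                        (sumₚ-zero proj₂-additive (All.map (λ {t} → m+n≡0⇒n≡0 (proj₁ t)) nul))
  sum-xs : sumₚ xs ≡ r
  sum-xs = trans (sym (+ₚ-identityʳ _)) (trans (cong (sumₚ xs +ₚ_) (sym zs-origin)) (trans (sym split) eq))
  len≤ : length xs ≤ weight r
  len≤ = ≤-trans (length≤sumₚ weight-additive pos) (≤-reflexive (cong weight sum-xs))

splitOffFst : ∀ {B x y} → SumOf B (x , y) →
  ∃₂ λ y₁ z → y₁ + z ≡ y × SumOfAtMost B x (x , y₁) × SumOf B (0 , z)
splitOffFst {B} {x} (_ , ts , ts⊆B , _ , eq) with splitByZero proj₁ ts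
... | xs , zs , pos , nul , split , sub =
  proj₂ (sumₚ xs) , proj₂ (sumₚ zs) , cong proj₂ sum≡ ,
  (xs , proj₁ (sub ts⊆B) , ≤-trans (length≤sumₚ proj₁-additive pos) (≤-reflexive x≡) , cong (_, _) x≡) ,
  (length zs , zs , proj₂ (sub ts⊆B) , ≤-refl , cong (_, proj₂ (sumₚ zs)) zs-fst)
  where
  sum≡ = trans (sym split) eq
  zs-fst : proj₁ (sumₚ zs) ≡ 0
  zs-fst = sumₚ-zero proj₁-additive nul
  x≡ : proj₁ (sumₚ xs) ≡ x
  x≡ = trans (sym (trans (cong (proj₁ (sumₚ xs) +_) zs-fst) (+-identityʳ _))) (cong proj₁ sum≡)

splitOffSnd : ∀ {B x y} → SumOf B (x , y) →
  ∃₂ λ x₁ z → x₁ + z ≡ x × SumOfAtMost B y (x₁ , y) × SumOf B (z , 0)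
splitOffSnd (k , rep) with splitOffFst (k , sumOfAtMost-swap rep)
... | x₁ , z , eq , (rep₁ , (l , rep₂)) = x₁ , z , eq , sumOfAtMost-unswap rep₁ , l , sumOfAtMost-unswap rep₂

sumOf⇒∈sumset-weight : ∀ {B r} → (0 , 0) ∈ B → SumOf B r → r ∈ sumset (weight r) B
sumOf⇒∈sumset-weight o∈B rep = sumOfAtMost⇒∈sumset o∈B (dropOrigin rep)

coprime⇒inverse : ∀ {α p} → Coprime α (2 + p) → ∃₂ λ s t → s * α ≡ 1 + t * (2 + p)
coprime⇒inverse {α} {p} cop with coprime-Bézout cop
... | Bézout.+- x y eq = x , y , sym eq
... | Bézout.-+ x zero    eq = contradiction eq 1+n≢0
... | Bézout.-+ x (suc y) eq = suc p * x , y + p * suc y , +-cancelˡ-≡ (suc p) _ _ (begin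
  suc p + suc p * x * α             ≡⟨ factor (suc p) x α ⟩
  suc p * (1 + x * α)               ≡⟨ cong (suc p *_) eq ⟩
  suc p * (suc y * (2 + p))         ≡⟨ expand p y ⟩
  suc p + (1 + (y + p * suc y) * (2 + p)) ∎)
  where
  open ≡-Reasoning
  factor : ∀ m x α → m + m * x * α ≡ m * (1 + x * α)
  factor = solve-∀
  expand : ∀ p y → suc p * (suc y * (2 + p)) ≡ suc p + (1 + (y + p * suc y) * (2 + p))
  expand = solve-∀

∸-congruence : ∀ {a b c d} n → a + b * n ≡ c + d * n → a ≤ c → c ∸ a ≡ (b ∸ d) * n
∸-congruence {a} {b} {c} {d} n eq a≤c = begin
  c ∸ a                      ≡⟨ m+n∸n≡m (c ∸ a) (d * n) ⟨
  c ∸ a + d * n ∸ d * n      ≡⟨ cong (_∸ d * n) (+-∸-comm (d * n) a≤c) ⟨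
  c + d * n ∸ a ∸ d * n      ≡⟨ cong (λ e → e ∸ a ∸ d * n) eq ⟨
  a + b * n ∸ a ∸ d * n      ≡⟨ cong (_∸ d * n) (m+n∸m≡n a (b * n)) ⟩
  b * n ∸ d * n              ≡⟨ *-distribʳ-∸ n b d ⟨
  (b ∸ d) * n                ∎
  where open ≡-Reasoning

-- With s α ≡ 1 (mod n), r = x s mod n satisfies r α ≡ x (mod n) and r α ≤ (n - 1) n ≤ x.
frobenius : ∀ {α p} → Coprime α (suc p) → α ≤ suc p → ∀ {x} → suc p * p ≤ x →
            ∃₂ λ i j → i ≤ p × i * α + j * suc p ≡ x
frobenius {p = zero} _ _ {x} _ = 0 , x , z≤n , *-identityʳ x
frobenius {α} {suc p} cop α≤n {x} x≥ with coprime⇒inverse cop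
... | s , t , sα≡1+tn = r , j , r≤ , x≡
  where
  n = 2 + p
  r = (x * s) % n
  d = (x * s) / n
  j = d * α ∸ x * t
  r≤ : r ≤ suc p
  r≤ = s≤s⁻¹ (m%n<n (x * s) n)
  rα≤x : r * α ≤ x
  rα≤x = ≤-trans (*-mono-≤ r≤ α≤n) (≤-trans (≤-reflexive (*-comm (suc p) n)) x≥)
  rα≡x-mod-n : r * α + (d * α) * n ≡ x + (x * t) * n
  rα≡x-mod-n = begin
    r * α + d * α * n   ≡⟨ factorʳ r d α n ⟩
    (r + d * n) * α     ≡⟨ cong (_* α) (m≡m%n+[m/n]*n (x * s) n) ⟨
    x * s * α           ≡⟨ *-assoc x s α ⟩
    x * (s * α)         ≡⟨ cong (x *_) sα≡1+tn ⟩
    x * (1 + t * n)     ≡⟨ expand x t n ⟩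
    x + x * t * n       ∎
    where
    open ≡-Reasoning
    factorʳ : ∀ r d α n → r * α + d * α * n ≡ (r + d * n) * α
    factorʳ = solve-∀
    expand : ∀ x t n → x * (1 + t * n) ≡ x + x * t * n
    expand = solve-∀
  x≡ : r * α + j * n ≡ x
  x≡ = trans (cong (r * α +_) (sym (∸-congruence {b = d * α} {d = x * t} n rα≡x-mod-n rα≤x))) (m+[n∸m]≡n rα≤x)

sum-replicate : ∀ n m → sum (replicate n m) ≡ n * m
sum-replicate zero    m = refl
sum-replicate (suc n) m = cong (m +_) (sum-replicate n m)

-- The nine points required to lie in A are grid a a' × grid b b'.
grid : ℕ → ℕ → List ℕ
grid α n = 0 ∷ α ∷ n ∷ []

frobenius-parts : ∀ {α p x h} → Coprime α (suc p) → α ≤ suc p → suc p * p ≤ x → x ≤ h * suc p →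
  ∃ λ us → All (_∈ grid α (suc p)) us × length us ≤ p + h × sum us ≡ x
frobenius-parts {α} {p} {x} {h} cop α≤ x≥ x≤ with frobenius cop α≤ x≥
... | i , j , i≤p , eq =
  us , All.++⁺ (All.replicate⁺ i (there (here refl))) (All.replicate⁺ j (there (there (here refl)))) , len≤ , sum≡
  where
  us = replicate i α ++ replicate j (suc p)
  j≤h : j ≤ h
  j≤h = *-cancelʳ-≤ j h (suc p) (≤-trans (m≤n+m (j * suc p) (i * α)) (≤-trans (≤-reflexive eq) x≤))
  len≤ : length us ≤ p + h
  len≤ = ≤-trans (≤-reflexive (trans (length-++ (replicate i α)) (cong₂ _+_ (length-replicate i) (length-replicate j))))
                 (+-mono-≤ i≤p j≤h)
  sum≡ : sum us ≡ x
  sum≡ = trans (sum-++ (replicate i α) _) (trans (cong₂ _+_ (sum-replicate i α) (sum-replicate j (suc p))) eq)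

record Admissible (B : List Pt) (p q α β : ℕ) : Set where
  field
    fst≤      : ∀ {t} → t ∈ B → proj₁ t ≤ suc p
    snd≤      : ∀ {t} → t ∈ B → proj₂ t ≤ suc q
    grid⊆     : ∀ {u v} → u ∈ grid α (suc p) → v ∈ grid β (suc q) → (u , v) ∈ B
    α-coprime : Coprime α (suc p)
    β-coprime : Coprime β (suc q)
    α≤        : α ≤ suc p
    β≤        : β ≤ suc q

  origin∈ : (0 , 0) ∈ B
  origin∈ = grid⊆ (here refl) (here refl)

  gridSum : ∀ {us vs k} → All (_∈ grid α (suc p)) us → All (_∈ grid β (suc q)) vs →
            length us ≤ k → length vs ≤ k → SumOfAtMost B k (sum us , sum vs)
  gridSum {us} {vs} us⊆ vs⊆ us≤ vs≤ =
    pairUp us vs , All-pairUp (here refl) (here refl) grid⊆ us⊆ vs⊆ , length-pairUp us vs us≤ vs≤ , sumₚ-pairUp us vs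

  sumOfAtMost-fst≤ : ∀ {k x y} → SumOfAtMost B k (x , y) → x ≤ k * suc p
  sumOfAtMost-fst≤ (ts , ts⊆B , len≤ , refl) =
    ≤-trans (sumₚ-≤ proj₁-additive (All.map fst≤ ts⊆B)) (*-monoˡ-≤ (suc p) len≤)

swap-admissible : ∀ {B p q α β} → Admissible B p q α β → Admissible (map swap B) q p β α
swap-admissible {B} {p} {q} H = record
  { fst≤ = ∈-map-elim (λ t → proj₁ t ≤ suc q) snd≤
  ; snd≤ = ∈-map-elim (λ t → proj₂ t ≤ suc p) fst≤
  ; grid⊆ = λ u∈ v∈ → ∈-map⁺ swap (grid⊆ v∈ u∈)
  ; α-coprime = β-coprime ; β-coprime = α-coprime ; α≤ = β≤ ; β≤ = α≤ }
  where
  open Admissible H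

below-square : ∀ {m x} → x < suc m * m → x + m < suc m * suc m
below-square {m} {x} x< = begin-strict
  x + m              <⟨ +-monoˡ-< m x< ⟩
  suc m * m + m      <⟨ n<1+n _ ⟩
  suc (suc m * m + m) ≡⟨ square-suc m ⟨
  suc m * suc m      ∎
  where
  open ≤-Reasoning
  square-suc : ∀ m → suc m * suc m ≡ suc (suc m * m + m)
  square-suc = solve-∀

small+≤ : ∀ p q {Q x} → suc p * suc p ≤ Q → suc q * suc q ≤ Q → x < suc p * p → x + q ≤ Q
small+≤ p q {x = x} hp hq x< with ≤-total q p
... | inj₁ q≤p = ≤-trans (+-monoʳ-≤ x q≤p) (<⇒≤ (≤-trans (below-square x<) hp))
... | inj₂ p≤q = <⇒≤ (≤-trans (below-square (≤-trans x< (*-mono-≤ (s≤s p≤q) p≤q))) hq)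

sumOf-swap : ∀ {B r} → SumOf B r → SumOf (map swap B) (swap r)
sumOf-swap (k , rep) = k , sumOfAtMost-swap rep

sumOf-unswap : ∀ {B r} → SumOf (map swap B) r → SumOf B (swap r)
sumOf-unswap (k , rep) = k , sumOfAtMost-unswap rep

module ConeFst {B p q α β} (H : Admissible B p q α β) {Q} (hp : suc p * suc p ≤ Q) (hq : suc q * suc q ≤ Q) where
  open Admissible H

  p≤Q : p ≤ Q
  p≤Q = ≤-trans (n≤1+n p) (≤-trans (m≤m*n (suc p) (suc p)) hp)

  pp≤Q : suc p * p ≤ Q
  pp≤Q = ≤-trans (*-monoʳ-≤ (suc p) (n≤1+n p)) hp

  qq≤Q : suc q * q ≤ Q
  qq≤Q = ≤-trans (*-monoʳ-≤ (suc q) (n≤1+n q)) hq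

  largeBoth : ∀ {x y h₁ h₂ k} → suc p * p ≤ x → suc q * q ≤ y → x ≤ h₁ * suc p → y ≤ h₂ * suc q →
              p + h₁ ≤ k → q + h₂ ≤ k → SumOfAtMost B k (x , y)
  largeBoth x≥ y≥ x≤ y≤ k₁ k₂ with frobenius-parts α-coprime α≤ x≥ x≤ | frobenius-parts β-coprime β≤ y≥ y≤
  ... | us , us⊆ , us≤ , refl | vs , vs⊆ , vs≤ , refl = gridSum us⊆ vs⊆ (≤-trans us≤ k₁) (≤-trans vs≤ k₂)

  largeFst : ∀ {x h} → suc p * p ≤ x → x ≤ h * suc p → SumOfAtMost B (p + h) (x , 0)
  largeFst x≥ x≤ with frobenius-parts α-coprime α≤ x≥ x≤
  ... | us , us⊆ , us≤ , refl = gridSum us⊆ [] us≤ z≤n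

  largeSnd : ∀ {y h} → suc q * q ≤ y → y ≤ h * suc q → SumOfAtMost B (q + h) (0 , y)
  largeSnd y≥ y≤ with frobenius-parts β-coprime β≤ y≥ y≤
  ... | vs , vs⊆ , vs≤ , refl = gridSum [] vs⊆ z≤n vs≤

  -- The summands with non-zero first coordinate number at most x; the remaining
  -- sum (0 , z) is rewritten with Frobenius if z is large, and has at most z
  -- non-zero summands otherwise.
  smallFst : ∀ {x y h k} → SumOf B (x , y) → x < suc p * p → y ≤ h * suc q → h + Q ≤ k → Q + Q ≤ k →
             SumOfAtMost B k (x , y)
  smallFst {x} {h = h} {k} rep x< y≤ k₁ k₂ with splitOffFst rep
  ... | y₁ , z , refl , xs , zs with suc q * q ≤? z
  ... | yes z≥ = sumOfAtMost-weaken len≤ (sumOfAtMost-++-snd xs (largeSnd z≥ (≤-trans (m≤n+m z y₁) y≤)))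
    where
    len≤ : x + (q + h) ≤ k
    len≤ = begin
      x + (q + h) ≡⟨ +-assoc x q h ⟨
      x + q + h   ≤⟨ +-monoˡ-≤ h (small+≤ p q hp hq x<) ⟩
      Q + h       ≡⟨ +-comm Q h ⟩
      h + Q       ≤⟨ k₁ ⟩
      k           ∎
      where open ≤-Reasoning
  ... | no z< = sumOfAtMost-weaken len≤ (sumOfAtMost-++-snd xs (dropOrigin zs))
    where
    len≤ : x + z ≤ k
    len≤ = ≤-trans (+-mono-≤ (≤-trans (<⇒≤ x<) pp≤Q) (≤-trans (<⇒≤ (≰⇒> z<)) qq≤Q)) k₂

  -- If y is small, the summands with non-zero second coordinate contribute at most
  -- y * suc p to the first coordinate; the rest is filled up by Frobenius.
  shiftFst : ∀ {x x₀ y} → Q * suc p ≤ x → SumOf B (x₀ , y) → SumOf B (x , y)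
  shiftFst {x} {y = y} x≥ rep with suc q * q ≤? y
  ... | yes y≥ = _ , largeBoth pp≤x y≥ (m≤m*n x (suc p)) (m≤m*n y (suc q)) (m≤m+n (p + x) (q + y)) (m≤n+m (q + y) (p + x))
    where
    pp≤x : suc p * p ≤ x
    pp≤x = ≤-trans (≤-reflexive (*-comm (suc p) p)) (≤-trans (*-monoˡ-≤ (suc p) p≤Q) x≥)
  ... | no y< with splitOffSnd rep
  ... | x₁ , _ , _ , ys , _ =
    _ , subst (λ x' → SumOfAtMost B (y + (p + (x ∸ x₁))) (x' , y)) (m+[n∸m]≡n x₁≤x)
          (sumOfAtMost-++-fst ys (largeFst {h = x ∸ x₁} rest≥ (m≤m*n (x ∸ x₁) (suc p))))
    where
    x₁+pp≤x : x₁ + suc p * p ≤ x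
    x₁+pp≤x = begin
      x₁ + suc p * p         ≤⟨ +-mono-≤ (sumOfAtMost-fst≤ ys) (≤-reflexive (*-comm (suc p) p)) ⟩
      y * suc p + p * suc p  ≡⟨ *-distribʳ-+ (suc p) y p ⟨
      (y + p) * suc p        ≤⟨ *-monoˡ-≤ (suc p) (small+≤ q p hq hp (≰⇒> y<)) ⟩
      Q * suc p              ≤⟨ x≥ ⟩
      x                      ∎
      where open ≤-Reasoning
    x₁≤x : x₁ ≤ x
    x₁≤x = ≤-trans (m≤m+n x₁ _) x₁+pp≤x
    rest≥ : suc p * p ≤ x ∸ x₁
    rest≥ = ≤-trans (≤-reflexive (sym (m+n∸m≡n x₁ _))) (∸-monoˡ-≤ x₁ x₁+pp≤x)

module Cone {B p q α β} (H : Admissible B p q α β) {Q} (hp : suc p * suc p ≤ Q) (hq : suc q * suc q ≤ Q) where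
  open Admissible H public
  open ConeFst H hp hq public
  private module Swapped = ConeFst (swap-admissible H) hq hp

  sumOf⇒sumOfAtMost : ∀ {x y h₁ h₂ k} → SumOf B (x , y) → x ≤ h₁ * suc p → y ≤ h₂ * suc q →
                      h₁ + Q ≤ k → h₂ + Q ≤ k → Q + Q ≤ k → SumOfAtMost B k (x , y)
  sumOf⇒sumOfAtMost {x} {y} {h₁} {h₂} rep x≤ y≤ k₁ k₂ kk with suc p * p ≤? x | suc q * q ≤? y
  ... | yes x≥ | yes y≥ = largeBoth x≥ y≥ x≤ y≤ (below-Q p≤Q k₁) (below-Q Swapped.p≤Q k₂)
    where
    below-Q : ∀ {m h k} → m ≤ Q → h + Q ≤ k → m + h ≤ k
    below-Q {m} {h} m≤Q h+Q≤k = ≤-trans (≤-reflexive (+-comm m h)) (≤-trans (+-monoʳ-≤ h m≤Q) h+Q≤k)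
  ... | no x< | _      = smallFst rep (≰⇒> x<) y≤ k₂ kk
  ... | yes _ | no y<  = sumOfAtMost-unswap (Swapped.smallFst (sumOf-swap rep) (≰⇒> y<) x≤ k₁ kk)

  shiftSnd : ∀ {x y y₀} → Q * suc q ≤ y → SumOf B (x , y₀) → SumOf B (x , y)
  shiftSnd y≥ rep = sumOf-unswap (Swapped.shiftFst y≥ (sumOf-swap rep))

reflectFst : ℕ → Pt → Pt
reflectFst c (u , v) = (c ∸ u , v)

reflectSnd : ℕ → Pt → Pt
reflectSnd c (u , v) = (u , c ∸ v)

∸-+-∸ : ∀ {a b c d} → b ≤ a → d ≤ c → (a ∸ b) + (c ∸ d) ≡ (a + c) ∸ (b + d)
∸-+-∸ {a} {b} {c} {d} b≤a d≤c = begin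
  (a ∸ b) + (c ∸ d)   ≡⟨ +-∸-assoc (a ∸ b) d≤c ⟨
  (a ∸ b) + c ∸ d     ≡⟨ cong (_∸ d) (+-∸-comm c b≤a) ⟨
  a + c ∸ b ∸ d       ≡⟨ ∸-+-assoc (a + c) b d ⟩
  a + c ∸ (b + d)     ∎
  where open ≡-Reasoning

sumₚ-reflectFst : ∀ {c ts} → All (λ t → proj₁ t ≤ c) ts →
                  sumₚ (map (reflectFst c) ts) ≡ reflectFst (length ts * c) (sumₚ ts)
sumₚ-reflectFst []                     = refl
sumₚ-reflectFst {c} {t ∷ ts} (t≤ ∷ ts≤) =
  trans (cong (reflectFst c t +ₚ_) (sumₚ-reflectFst ts≤))
        (cong (_, proj₂ (sumₚ (t ∷ ts))) (∸-+-∸ t≤ (sumₚ-≤ proj₁-additive ts≤)))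

∈sumset-map : ∀ {B B' k r} (φ Φ : Pt → Pt) →
  (∀ {ts} → All (_∈ B) ts → length ts ≡ k → sumₚ (map φ ts) ≡ Φ (sumₚ ts)) →
  (∀ {t} → t ∈ B → φ t ∈ B') → r ∈ sumset k B → Φ r ∈ sumset k B'
∈sumset-map {B} {B'} {k} φ Φ sum-map maps r∈ with ∈sumset⇒sumOfLength B k r∈
... | ts , ts⊆B , len , refl = subst₂ (λ n s → s ∈ sumset n B') (trans (length-map φ ts) len) (sum-map ts⊆B len)
                                 (sumₚ∈sumset (All.map⁺ (All.map maps ts⊆B)))

∈sumset-swap : ∀ {B B'} {k} {r} → (∀ {t} → t ∈ B → swap t ∈ B') → r ∈ sumset k B → swap r ∈ sumset k B'
∈sumset-swap {k = k} = ∈sumset-map {k = k} swap swap (λ {ts} _ _ → sumₚ-swap ts)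

∈sumset-reflectFst : ∀ {B B' c k r} → (∀ {t} → t ∈ B → proj₁ t ≤ c) → (∀ {t} → t ∈ B → reflectFst c t ∈ B') →
                     r ∈ sumset k B → reflectFst (k * c) r ∈ sumset k B'
∈sumset-reflectFst {c = c} {k} bound = ∈sumset-map {k = k} (reflectFst c) (reflectFst (k * c))
  (λ {ts} ts⊆B len → trans (sumₚ-reflectFst (All.map bound ts⊆B)) (cong (λ n → reflectFst (n * c) (sumₚ ts)) len))

-- reflectSnd c = swap ∘ reflectFst c ∘ swap
∈sumset-reflectSnd : ∀ {B B' c k r} → (∀ {t} → t ∈ B → proj₂ t ≤ c) → (∀ {t} → t ∈ B → reflectSnd c t ∈ B') →
                     r ∈ sumset k B → reflectSnd (k * c) r ∈ sumset k B'
∈sumset-reflectSnd {B} {B'} {c} {k} bound maps =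
    ∈sumset-swap {k = k} back
  ∘ ∈sumset-reflectFst {k = k} (∈-map-elim (λ t → proj₁ t ≤ c) bound) (∈-map⁺ (reflectFst c))
  ∘ ∈sumset-swap {k = k} (∈-map⁺ swap)
  where
  back : ∀ {t} → t ∈ map (reflectFst c) (map swap B) → swap t ∈ B'
  back = ∈-map-elim (λ t → swap t ∈ B') (∈-map-elim (λ t → swap (reflectFst c t) ∈ B') maps)

reflectFst-involutive : ∀ {c t} → proj₁ t ≤ c → reflectFst c (reflectFst c t) ≡ t
reflectFst-involutive t≤c = cong (_, _) (m∸[m∸n]≡n t≤c)

reflectSnd-involutive : ∀ {c t} → proj₂ t ≤ c → reflectSnd c (reflectSnd c t) ≡ t
reflectSnd-involutive t≤c = cong (_ ,_) (m∸[m∸n]≡n t≤c)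

coprime-∸ : ∀ {α n} → α ≤ n → Coprime α n → Coprime (n ∸ α) n
coprime-∸ α≤n cop (d∣n∸α , d∣n) = cop (∣m+n∣m⇒∣n (subst (_ ∣_) (sym (m∸n+n≡m α≤n)) d∣n) d∣n∸α , d∣n)

reflectFst-admissible : ∀ {B p q α β} → Admissible B p q α β →
                        Admissible (map (reflectFst (suc p)) B) p q (suc p ∸ α) β
reflectFst-admissible {B} {p} {q} {α} {β} H = record
  { fst≤ = ∈-map-elim (λ t → proj₁ t ≤ suc p) (λ {s} _ → m∸n≤m (suc p) (proj₁ s))
  ; snd≤ = ∈-map-elim (λ t → proj₂ t ≤ suc q) snd≤
  ; grid⊆ = reflected-grid⊆
  ; α-coprime = coprime-∸ α≤ α-coprime
  ; β-coprime = β-coprime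
  ; α≤ = m∸n≤m (suc p) α
  ; β≤ = β≤ }
  where
  open Admissible H
  reflected-grid⊆ : ∀ {u v} → u ∈ grid (suc p ∸ α) (suc p) → v ∈ grid β (suc q) → (u , v) ∈ map (reflectFst (suc p)) B
  reflected-grid⊆ {v = v} (here refl) v∈ =
    subst (λ w → (w , v) ∈ map (reflectFst (suc p)) B) (n∸n≡0 (suc p)) (∈-map⁺ _ (grid⊆ (there (there (here refl))) v∈))
  reflected-grid⊆ (there (here refl))         v∈ = ∈-map⁺ _ (grid⊆ (there (here refl)) v∈)
  reflected-grid⊆ (there (there (here refl))) v∈ = ∈-map⁺ _ (grid⊆ (here refl) v∈)

reflectSnd-admissible : ∀ {B p q α β} → Admissible B p q α β →
                        Admissible (map (reflectSnd (suc q)) B) p q α (suc q ∸ β)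
reflectSnd-admissible {B} {p} {q} {α} {β} H =
  subst (λ B' → Admissible B' p q α (suc q ∸ β)) conjugate (swap-admissible (reflectFst-admissible (swap-admissible H)))
  where
  conjugate : map swap (map (reflectFst (suc q)) (map swap B)) ≡ map (reflectSnd (suc q)) B
  conjugate = sym (trans (map-∘ B) (cong (map swap) (map-∘ B)))

sumBelow : ℕ → (ℕ → ℕ) → ℕ
sumBelow zero    f = 0
sumBelow (suc n) f = f n + sumBelow n f

syntax sumBelow n (λ i → e) = ∑[ i < n ] e

∑-cong : ∀ n {f g : ℕ → ℕ} → (∀ i → i < n → f i ≡ g i) → ∑[ i < n ] f i ≡ ∑[ i < n ] g i
∑-cong zero    h = refl
∑-cong (suc n) h = cong₂ _+_ (h n ≤-refl) (∑-cong n (λ i i<n → h i (m<n⇒m<1+n i<n)))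

∑-split : ∀ m n (f : ℕ → ℕ) → ∑[ i < m + n ] f i ≡ ∑[ i < m ] f i + ∑[ i < n ] f (m + i)
∑-split m zero    f = trans (cong (λ k → sumBelow k f) (+-identityʳ m)) (sym (+-identityʳ _))
∑-split m (suc n) f = begin
  ∑[ i < m + suc n ] f i                                ≡⟨ cong (λ k → sumBelow k f) (+-suc m n) ⟩
  f (m + n) + ∑[ i < m + n ] f i                        ≡⟨ cong (f (m + n) +_) (∑-split m n f) ⟩
  f (m + n) + (∑[ i < m ] f i + ∑[ i < n ] f (m + i))   ≡⟨ +-exchange (f (m + n)) (∑[ i < m ] f i) (∑[ i < n ] f (m + i)) ⟩
  ∑[ i < m ] f i + (f (m + n) + ∑[ i < n ] f (m + i))   ∎
  where
  open ≡-Reasoning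
  +-exchange : ∀ a b c → a + (b + c) ≡ b + (a + c)
  +-exchange = solve-∀

∑-reverse : ∀ n (f : ℕ → ℕ) → ∑[ i < n ] f i ≡ ∑[ i < n ] f (n ∸ suc i)
∑-reverse zero    f = refl
∑-reverse (suc n) f = begin
  f n + ∑[ i < n ] f i                    ≡⟨ cong (f n +_) (∑-reverse n f) ⟩
  f n + ∑[ i < n ] f (n ∸ suc i)
    ≡⟨ trans (∑-split 1 n (λ i → f (n ∸ i))) (cong (_+ ∑[ i < n ] f (n ∸ suc i)) (+-identityʳ (f n))) ⟨
  ∑[ i < suc n ] f (n ∸ i)                ∎
  where open ≡-Reasoning

∑-const : ∀ n c → ∑[ i < n ] c ≡ n * c
∑-const zero    c = refl
∑-const (suc n) c = cong (c +_) (∑-const n c)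

∑-+ : ∀ n (f g : ℕ → ℕ) → ∑[ i < n ] (f i + g i) ≡ ∑[ i < n ] f i + ∑[ i < n ] g i
∑-+ zero    f g = refl
∑-+ (suc n) f g = trans (cong (f n + g n +_) (∑-+ n f g)) (interchange (f n) (g n) _ _)

∑-*ˡ : ∀ n c (f : ℕ → ℕ) → ∑[ i < n ] (c * f i) ≡ c * ∑[ i < n ] f i
∑-*ˡ zero    c f = sym (*-zeroʳ c)
∑-*ˡ (suc n) c f = trans (cong (c * f n +_) (∑-*ˡ n c f)) (sym (*-distribˡ-+ c (f n) _))

∑-split-reverse : ∀ m n N (f : ℕ → ℕ) → m + n ≡ suc N → ∑[ i < suc N ] f i ≡ ∑[ i < m ] f i + ∑[ i < n ] f (N ∸ i)
∑-split-reverse m n N f m+n≡ = begin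
  ∑[ i < suc N ] f i                            ≡⟨ cong (λ k → sumBelow k f) m+n≡ ⟨
  ∑[ i < m + n ] f i                            ≡⟨ ∑-split m n f ⟩
  ∑[ i < m ] f i + ∑[ i < n ] f (m + i)
    ≡⟨ cong (∑[ i < m ] f i +_) (trans (∑-reverse n _) (∑-cong n (λ i i<n → cong f (index i i<n)))) ⟩
  ∑[ i < m ] f i + ∑[ i < n ] f (N ∸ i)         ∎
  where
  open ≡-Reasoning
  index : ∀ i → i < n → m + (n ∸ suc i) ≡ N ∸ i
  index i i<n = trans (sym (+-∸-assoc m i<n)) (cong (_∸ suc i) m+n≡)

∑-corner : ∀ X₁ Y₁ dX dY (f : ℕ → ℕ → ℕ) →
  (∀ x y → X₁ ≤ x → f x y ≡ f X₁ y) → (∀ x y → Y₁ ≤ y → f x y ≡ f x Y₁) → f X₁ Y₁ ≡ 1 →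
  ∑[ x < X₁ + dX ] ∑[ y < Y₁ + dY ] f x y ≡
    ∑[ x < X₁ ] ∑[ y < Y₁ ] f x y + dY * ∑[ x < X₁ ] f x Y₁ + dX * ∑[ y < Y₁ ] f X₁ y + dX * dY
∑-corner X₁ Y₁ dX dY f stableˣ stableʸ f₁ = begin
  ∑[ x < X₁ + dX ] ∑[ y < Y₁ + dY ] f x y
    ≡⟨ ∑-split X₁ dX _ ⟩
  ∑[ x < X₁ ] ∑[ y < Y₁ + dY ] f x y + ∑[ i < dX ] ∑[ y < Y₁ + dY ] f (X₁ + i) y
    ≡⟨ cong₂ _+_ (∑-cong X₁ (λ x _ → ∑-split Y₁ dY (f x)))
                 (∑-cong dX (λ i _ → ∑-cong (Y₁ + dY) (λ y _ → stableˣ (X₁ + i) y (m≤m+n X₁ i)))) ⟩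
  ∑[ x < X₁ ] (∑[ y < Y₁ ] f x y + ∑[ j < dY ] f x (Y₁ + j)) + ∑[ i < dX ] ∑[ y < Y₁ + dY ] f X₁ y
    ≡⟨ cong₂ _+_ (∑-+ X₁ _ _) (∑-const dX _) ⟩
  ∑[ x < X₁ ] ∑[ y < Y₁ ] f x y + ∑[ x < X₁ ] ∑[ j < dY ] f x (Y₁ + j) + dX * ∑[ y < Y₁ + dY ] f X₁ y
    ≡⟨ cong₂ _+_ (cong (_ +_) (∑-cong X₁ (λ x _ → trans (∑-cong dY (λ j _ → stableʸ x (Y₁ + j) (m≤m+n Y₁ j))) (∑-const dY _))))
                 (cong (dX *_) (∑-split Y₁ dY (f X₁))) ⟩
  ∑[ x < X₁ ] ∑[ y < Y₁ ] f x y + ∑[ x < X₁ ] (dY * f x Y₁) + dX * (∑[ y < Y₁ ] f X₁ y + ∑[ j < dY ] f X₁ (Y₁ + j))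
    ≡⟨ cong₂ _+_ (cong (_ +_) (∑-*ˡ X₁ dY _))
                 (cong (λ z → dX * (∑[ y < Y₁ ] f X₁ y + z))
                       (trans (∑-cong dY (λ j _ → trans (stableʸ X₁ (Y₁ + j) (m≤m+n Y₁ j)) f₁)) (trans (∑-const dY 1) (*-identityʳ dY)))) ⟩
  ∑[ x < X₁ ] ∑[ y < Y₁ ] f x y + dY * ∑[ x < X₁ ] f x Y₁ + dX * (∑[ y < Y₁ ] f X₁ y + dY)
    ≡⟨ distribute (∑[ x < X₁ ] ∑[ y < Y₁ ] f x y) (dY * ∑[ x < X₁ ] f x Y₁) dX (∑[ y < Y₁ ] f X₁ y) dY ⟩
  ∑[ x < X₁ ] ∑[ y < Y₁ ] f x y + dY * ∑[ x < X₁ ] f x Y₁ + dX * ∑[ y < Y₁ ] f X₁ y + dX * dY ∎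
  where
  open ≡-Reasoning
  distribute : ∀ a b c d e → a + b + c * (d + e) ≡ a + b + c * d + c * e
  distribute = solve-∀

∑-quadrants : ∀ XL XR YB YT NX NY (g : ℕ → ℕ → ℕ) → XL + XR ≡ suc NX → YB + YT ≡ suc NY →
  ∑[ x < suc NX ] ∑[ y < suc NY ] g x y ≡
    ∑[ x < XL ] ∑[ y < YB ] g x y + ∑[ x < XL ] ∑[ j < YT ] g x (NY ∸ j)
    + ∑[ i < XR ] ∑[ y < YB ] g (NX ∸ i) y + ∑[ i < XR ] ∑[ j < YT ] g (NX ∸ i) (NY ∸ j)
∑-quadrants XL XR YB YT NX NY g eX eY = begin
  ∑[ x < suc NX ] F x                          ≡⟨ ∑-split-reverse XL XR NX F eX ⟩
  ∑[ x < XL ] F x + ∑[ i < XR ] F (NX ∸ i)     ≡⟨ cong₂ _+_ (∑-cong XL (λ x _ → F-split x)) (∑-cong XR (λ i _ → F-split (NX ∸ i))) ⟩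
  ∑[ x < XL ] (near x + far x) + ∑[ i < XR ] (near (NX ∸ i) + far (NX ∸ i))
                                               ≡⟨ cong₂ _+_ (∑-+ XL near far) (∑-+ XR (near ∘ (NX ∸_)) (far ∘ (NX ∸_))) ⟩
  c₀₀ + c₀₁ + (c₁₀ + c₁₁)                      ≡⟨ +-assoc (c₀₀ + c₀₁) c₁₀ c₁₁ ⟨
  c₀₀ + c₀₁ + c₁₀ + c₁₁                        ∎
  where
  open ≡-Reasoning
  F near far : ℕ → ℕ
  F x = ∑[ y < suc NY ] g x y
  near x = ∑[ y < YB ] g x y
  far x = ∑[ j < YT ] g x (NY ∸ j)
  c₀₀ = ∑[ x < XL ] near x
  c₀₁ = ∑[ x < XL ] far x
  c₁₀ = ∑[ i < XR ] near (NX ∸ i)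
  c₁₁ = ∑[ i < XR ] far (NX ∸ i)
  F-split : ∀ x → F x ≡ near x + far x
  F-split x = ∑-split-reverse YB YT NY (g x) eY

indicator : ∀ {P : Set} → Dec P → ℕ
indicator (yes _) = 1
indicator (no _)  = 0

indicator-cong : ∀ {P Q : Set} (p? : Dec P) (q? : Dec Q) → (P → Q) → (Q → P) → indicator p? ≡ indicator q?
indicator-cong (yes _) (yes _) _   _   = refl
indicator-cong (yes p) (no ¬q) p⇒q _   = contradiction (p⇒q p) ¬q
indicator-cong (no ¬p) (yes q) _   q⇒p = contradiction (q⇒p q) ¬p
indicator-cong (no _)  (no _)  _   _   = refl

columnPoints : ℕ → ℕ → List Pt
columnPoints x zero    = []
columnPoints x (suc Y) = (x , Y) ∷ columnPoints x Y

boxPoints : ℕ → ℕ → List Pt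
boxPoints zero    Y = []
boxPoints (suc X) Y = columnPoints X Y ++ boxPoints X Y

∈-columnPoints⁻ : ∀ {x Y z} → z ∈ columnPoints x Y → proj₁ z ≡ x × proj₂ z < Y
∈-columnPoints⁻ {Y = suc Y} (here refl) = refl , ≤-refl
∈-columnPoints⁻ {Y = suc Y} (there z∈) with ∈-columnPoints⁻ z∈
... | z₁≡ , z₂< = z₁≡ , m<n⇒m<1+n z₂<

∈-columnPoints⁺ : ∀ {x Y y} → y < Y → (x , y) ∈ columnPoints x Y
∈-columnPoints⁺ {Y = suc Y} {y} y< with y ≟ Y
... | yes refl = here refl
... | no y≢Y   = there (∈-columnPoints⁺ (≤∧≢⇒< (s≤s⁻¹ y<) y≢Y))

∈-boxPoints⁻ : ∀ {X Y z} → z ∈ boxPoints X Y → proj₁ z < X × proj₂ z < Y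
∈-boxPoints⁻ {suc X} {Y} z∈ with ∈-++⁻ (columnPoints X Y) z∈
... | inj₁ z∈col with ∈-columnPoints⁻ z∈col
...   | refl , z₂< = ≤-refl , z₂<
∈-boxPoints⁻ {suc X} {Y} z∈ | inj₂ z∈box with ∈-boxPoints⁻ {X} z∈box
...   | z₁< , z₂< = m<n⇒m<1+n z₁< , z₂<

∈-boxPoints⁺ : ∀ {X Y x y} → x < X → y < Y → (x , y) ∈ boxPoints X Y
∈-boxPoints⁺ {suc X} {Y} {x} x< y< with x ≟ X
... | yes refl = ∈-++⁺ˡ (∈-columnPoints⁺ y<)
... | no x≢X   = ∈-++⁺ʳ (columnPoints X Y) (∈-boxPoints⁺ (≤∧≢⇒< (s≤s⁻¹ x<) x≢X) y<)

columnPoints-unique : ∀ x Y → Unique (columnPoints x Y)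
columnPoints-unique x zero    = []
columnPoints-unique x (suc Y) =
  All.tabulate (λ z∈ Y,≡z → <-irrefl refl (proj₂ (∈-columnPoints⁻ (subst (_∈ columnPoints x Y) (sym Y,≡z) z∈))))
  ∷ columnPoints-unique x Y

boxPoints-unique : ∀ X Y → Unique (boxPoints X Y)
boxPoints-unique zero    Y = []
boxPoints-unique (suc X) Y = Unique.++⁺ (columnPoints-unique X Y) (boxPoints-unique X Y)
  (λ (z∈col , z∈box) → <-irrefl (proj₁ (∈-columnPoints⁻ z∈col)) (proj₁ (∈-boxPoints⁻ z∈box)))

length-filter-columnPoints : ∀ {P : Pt → Set} (P? : Decidable P) x Y →
  length (filter P? (columnPoints x Y)) ≡ ∑[ y < Y ] indicator (P? (x , y))
length-filter-columnPoints P? x zero    = refl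
length-filter-columnPoints P? x (suc Y) with P? (x , Y)
... | yes _ = cong suc (length-filter-columnPoints P? x Y)
... | no _  = length-filter-columnPoints P? x Y

length-filter-boxPoints : ∀ {P : Pt → Set} (P? : Decidable P) X Y →
  length (filter P? (boxPoints X Y)) ≡ ∑[ x < X ] ∑[ y < Y ] indicator (P? (x , y))
length-filter-boxPoints P? zero    Y = refl
length-filter-boxPoints P? (suc X) Y = begin
  length (filter P? (columnPoints X Y ++ boxPoints X Y))
    ≡⟨ cong length (filter-++ P? (columnPoints X Y) (boxPoints X Y)) ⟩
  length (filter P? (columnPoints X Y) ++ filter P? (boxPoints X Y))
    ≡⟨ length-++ (filter P? (columnPoints X Y)) ⟩
  length (filter P? (columnPoints X Y)) + length (filter P? (boxPoints X Y))
    ≡⟨ cong₂ _+_ (length-filter-columnPoints P? X Y) (length-filter-boxPoints P? X Y) ⟩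
  ∑[ x < suc X ] ∑[ y < Y ] indicator (P? (x , y)) ∎
  where open ≡-Reasoning

-- deduplicate l and the points of the box lying in l are the same set, both without repetitions.
length-deduplicate≡∑ : ∀ X Y l → (∀ {z} → z ∈ l → proj₁ z < X × proj₂ z < Y) →
  length (deduplicate _≟ₚ_ l) ≡ ∑[ x < X ] ∑[ y < Y ] indicator ((x , y) ∈? l)
length-deduplicate≡∑ X Y l l⊆box =
  trans (↭-length (∼bag⇒↭ (unique∧set⇒bag (deduplicate-! l) (Unique.filter⁺ (_∈? l) (boxPoints-unique X Y)) (mk⇔ to from))))
        (length-filter-boxPoints (_∈? l) X Y)
  where
  to : ∀ {z} → z ∈ deduplicate _≟ₚ_ l → z ∈ filter (_∈? l) (boxPoints X Y)
  to z∈ = let z∈l = ∈-deduplicate⁻ _≟ₚ_ l z∈ in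
          ∈-filter⁺ (_∈? l) (∈-boxPoints⁺ (proj₁ (l⊆box z∈l)) (proj₂ (l⊆box z∈l))) z∈l
  from : ∀ {z} → z ∈ filter (_∈? l) (boxPoints X Y) → z ∈ deduplicate _≟ₚ_ l
  from z∈ = ∈-deduplicate⁺ _≟ₚ_ (proj₂ (∈-filter⁻ (_∈? l) {xs = boxPoints X Y} z∈))

inSumset : ℕ → List Pt → ℕ → ℕ → ℕ
inSumset k B x y = indicator ((x , y) ∈? sumset k B)

inSumset-reflectFst : ∀ {B c} k {i y} → (∀ {t} → t ∈ B → proj₁ t ≤ c) → i ≤ k * c →
                      inSumset k B (k * c ∸ i) y ≡ inSumset k (map (reflectFst c) B) i y
inSumset-reflectFst {B} {c} k {i} {y} bound i≤ = indicator-cong _ _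
  (subst (λ x → (x , y) ∈ sumset k (map (reflectFst c) B)) (m∸[m∸n]≡n i≤) ∘ ∈sumset-reflectFst {k = k} bound (∈-map⁺ _))
  (∈sumset-reflectFst {k = k} (∈-map-elim (λ t → proj₁ t ≤ c) (λ {s} _ → m∸n≤m c (proj₁ s)))
                              (∈-map-elim (λ t → reflectFst c t ∈ B) (λ s∈ → subst (_∈ B) (sym (reflectFst-involutive (bound s∈))) s∈)))

inSumset-reflectSnd : ∀ {B c} k {x j} → (∀ {t} → t ∈ B → proj₂ t ≤ c) → j ≤ k * c →
                      inSumset k B x (k * c ∸ j) ≡ inSumset k (map (reflectSnd c) B) x j
inSumset-reflectSnd {B} {c} k {x} {j} bound j≤ = indicator-cong _ _
  (subst (λ y → (x , y) ∈ sumset k (map (reflectSnd c) B)) (m∸[m∸n]≡n j≤) ∘ ∈sumset-reflectSnd {k = k} bound (∈-map⁺ _))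
  (∈sumset-reflectSnd {k = k} (∈-map-elim (λ t → proj₂ t ≤ c) (λ {s} _ → m∸n≤m c (proj₂ s)))
                              (∈-map-elim (λ t → reflectSnd c t ∈ B) (λ s∈ → subst (_∈ B) (sym (reflectSnd-involutive (bound s∈))) s∈)))

module ConeCount {B p q α β} (H : Admissible B p q α β) {Q} (hp : suc p * suc p ≤ Q) (hq : suc q * suc q ≤ Q) where
  open Cone H hp hq

  -- Indicator of SumOf B (x , y); as (0 , 0) ∈ B, at most x + y summands are needed, which makes it decidable.
  cone : ℕ → ℕ → ℕ
  cone x y = inSumset (x + y) B x y

  cone-cong : ∀ {x y x' y'} → (SumOf B (x , y) → SumOf B (x' , y')) → (SumOf B (x' , y') → SumOf B (x , y)) →
              cone x y ≡ cone x' y'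
  cone-cong {x} {y} {x'} {y'} to from = indicator-cong _ _
    (sumOf⇒∈sumset-weight origin∈ ∘ to ∘ ∈sumset⇒sumOf (x + y))
    (sumOf⇒∈sumset-weight origin∈ ∘ from ∘ ∈sumset⇒sumOf (x' + y'))

  X₁ Y₁ : ℕ
  X₁ = Q * suc p
  Y₁ = Q * suc q

  cone-stableˣ : ∀ x y → X₁ ≤ x → cone x y ≡ cone X₁ y
  cone-stableˣ x y x≥ = cone-cong (shiftFst ≤-refl) (shiftFst x≥)

  cone-stableʸ : ∀ x y → Y₁ ≤ y → cone x y ≡ cone x Y₁
  cone-stableʸ x y y≥ = cone-cong (shiftSnd ≤-refl) (shiftSnd y≥)

  cone-corner : cone X₁ Y₁ ≡ 1
  cone-corner with (X₁ , Y₁) ∈? sumset (X₁ + Y₁) B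
  ... | yes _ = refl
  ... | no ∉  = contradiction (sumOf⇒∈sumset-weight origin∈ (shiftFst ≤-refl (shiftSnd ≤-refl origin-sum))) ∉
    where
    origin-sum : SumOf B (0 , 0)
    origin-sum = 0 , [] , [] , z≤n , refl

  boxCount rowCount columnCount : ℕ
  boxCount    = ∑[ x < X₁ ] ∑[ y < Y₁ ] cone x y
  rowCount    = ∑[ x < X₁ ] cone x Y₁
  columnCount = ∑[ y < Y₁ ] cone X₁ y

  inSumset≡cone : ∀ {k h₁ h₂ x y} → x ≤ h₁ * suc p → y ≤ h₂ * suc q → h₁ + Q ≤ k → h₂ + Q ≤ k → Q + Q ≤ k →
                  inSumset k B x y ≡ cone x y
  inSumset≡cone {k} {x = x} {y} x≤ y≤ k₁ k₂ kk = indicator-cong _ _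
    (sumOf⇒∈sumset-weight origin∈ ∘ ∈sumset⇒sumOf k)
    (sumOfAtMost⇒∈sumset origin∈ ∘ (λ rep → sumOf⇒sumOfAtMost rep x≤ y≤ k₁ k₂ kk) ∘ ∈sumset⇒sumOf (x + y))

  ∑-inSumset : ∀ {k h₁ h₂} dX dY → X₁ + dX ≤ suc (h₁ * suc p) → Y₁ + dY ≤ suc (h₂ * suc q) →
               h₁ + Q ≤ k → h₂ + Q ≤ k → Q + Q ≤ k →
               ∑[ x < X₁ + dX ] ∑[ y < Y₁ + dY ] inSumset k B x y ≡ boxCount + dY * rowCount + dX * columnCount + dX * dY
  ∑-inSumset dX dY X≤ Y≤ k₁ k₂ kk = trans
    (∑-cong (X₁ + dX) (λ x x< → ∑-cong (Y₁ + dY) (λ y y< →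
      inSumset≡cone (s≤s⁻¹ (≤-trans x< X≤)) (s≤s⁻¹ (≤-trans y< Y≤)) k₁ k₂ kk)))
    (∑-corner X₁ Y₁ dX dY cone cone-stableˣ cone-stableʸ cone-corner)

module Count {A p q α β} (H : Admissible A p q α β) where
  open Admissible H using (fst≤; snd≤)

  sp sq Q : ℕ
  sp = suc p
  sq = suc q
  Q  = sp * sp ⊔ sq * sq

  hp : sp * sp ≤ Q
  hp = m≤m⊔n (sp * sp) (sq * sq)

  hq : sq * sq ≤ Q
  hq = m≤n⊔m (sp * sp) (sq * sq)

  -- The corners (0 , 0), (k sp , 0), (0 , k sq) and (k sp , k sq) of the bounding box of kA,
  -- each seen from the corner itself.
  module C₀₀ = ConeCount H hp hq
  module C₁₀ = ConeCount (reflectFst-admissible H) hp hq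
  module C₀₁ = ConeCount (reflectSnd-admissible H) hp hq
  module C₁₁ = ConeCount (reflectSnd-admissible (reflectFst-admissible H)) hp hq

  c g h : ℕ
  c = C₀₀.boxCount + C₀₁.boxCount + C₁₀.boxCount + C₁₁.boxCount
  g = C₀₀.rowCount + C₁₀.rowCount
  h = C₀₀.columnCount + C₀₁.columnCount

  sumset-inBox : ∀ k {z} → z ∈ sumset k A → proj₁ z < suc (k * sp) × proj₂ z < suc (k * sq)
  sumset-inBox k z∈ with ∈sumset⇒sumOfLength A k z∈
  ... | ts , ts⊆A , refl , refl =
    s≤s (sumₚ-≤ proj₁-additive (All.map fst≤ ts⊆A)) , s≤s (sumₚ-≤ proj₂-additive (All.map snd≤ ts⊆A))

  card-sumset≡ : ∀ D → card-sumset (D + (Q + Q)) A ≡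
                 c + suc (D * sq) * g + suc (D * sp) * h + suc (D * sp) * suc (D * sq)
  card-sumset≡ D = begin
    card-sumset k A
      ≡⟨ length-deduplicate≡∑ (suc (k * sp)) (suc (k * sq)) (sumset k A) (sumset-inBox k) ⟩
    ∑[ x < suc (k * sp) ] ∑[ y < suc (k * sq) ] inSumset k A x y
      ≡⟨ ∑-quadrants (X₁ + dX) (X₁ + 0) (Y₁ + dY) (Y₁ + 0) (k * sp) (k * sq) (inSumset k A) (whole sp) (whole sq) ⟩
    ∑[ x < X₁ + dX ] ∑[ y < Y₁ + dY ] inSumset k A x y
      + ∑[ x < X₁ + dX ] ∑[ j < Y₁ + 0 ] inSumset k A x (k * sq ∸ j)
      + ∑[ i < X₁ + 0 ] ∑[ y < Y₁ + dY ] inSumset k A (k * sp ∸ i) y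
      + ∑[ i < X₁ + 0 ] ∑[ j < Y₁ + 0 ] inSumset k A (k * sp ∸ i) (k * sq ∸ j)
      ≡⟨ cong₂ _+_ (cong₂ _+_ (cong₂ _+_ corner₀₀ corner₀₁) corner₁₀) corner₁₁ ⟩
    C₀₀.boxCount + dY * C₀₀.rowCount + dX * C₀₀.columnCount + dX * dY
      + (C₀₁.boxCount + 0 * C₀₁.rowCount + dX * C₀₁.columnCount + dX * 0)
      + (C₁₀.boxCount + dY * C₁₀.rowCount + 0 * C₁₀.columnCount + 0 * dY)
      + (C₁₁.boxCount + 0 * C₁₁.rowCount + 0 * C₁₁.columnCount + 0 * 0)
      ≡⟨ collect C₀₀.boxCount C₀₁.boxCount C₁₀.boxCount C₁₁.boxCount C₀₀.rowCount C₀₁.rowCount C₁₀.rowCount C₁₁.rowCount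
                 C₀₀.columnCount C₀₁.columnCount C₁₀.columnCount C₁₁.columnCount dX dY ⟩
    c + dY * g + dX * h + dX * dY ∎
    where
    open ≡-Reasoning
    k dX dY X₁ Y₁ : ℕ
    k  = D + (Q + Q)
    dX = suc (D * sp)
    dY = suc (D * sq)
    X₁ = Q * sp
    Y₁ = Q * sq

    whole : ∀ s → Q * s + suc (D * s) + (Q * s + 0) ≡ suc (k * s)
    whole s = lemma Q D s
      where
      lemma : ∀ Q D s → Q * s + suc (D * s) + (Q * s + 0) ≡ suc ((D + (Q + Q)) * s)
      lemma = solve-∀

    near : ∀ s → Q * s + suc (D * s) ≤ suc ((D + Q) * s)
    near s = ≤-reflexive (lemma Q D s)
      where
      lemma : ∀ Q D s → Q * s + suc (D * s) ≡ suc ((D + Q) * s)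
      lemma = solve-∀

    far : ∀ s → Q * s + 0 ≤ suc (Q * s)
    far s = ≤-trans (≤-reflexive (+-identityʳ (Q * s))) (n≤1+n (Q * s))

    far≤k : ∀ s {i} → i < Q * s + 0 → i ≤ k * s
    far≤k s i< = ≤-trans (s≤s⁻¹ (≤-trans i< (far s))) (*-monoˡ-≤ s (≤-trans (m≤m+n Q Q) (m≤n+m (Q + Q) D)))

    D+Q+Q≤k : D + Q + Q ≤ k
    D+Q+Q≤k = ≤-reflexive (+-assoc D Q Q)

    Q+Q≤k : Q + Q ≤ k
    Q+Q≤k = m≤n+m (Q + Q) D

    corner₀₀ = C₀₀.∑-inSumset dX dY (near sp) (near sq) D+Q+Q≤k D+Q+Q≤k Q+Q≤k
    corner₀₁ = trans (∑-cong (X₁ + dX) (λ x _ → ∑-cong (Y₁ + 0) (λ j j< → inSumset-reflectSnd k snd≤ (far≤k sq j<))))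
                     (C₀₁.∑-inSumset dX 0 (near sp) (far sq) D+Q+Q≤k Q+Q≤k Q+Q≤k)
    corner₁₀ = trans (∑-cong (X₁ + 0) (λ i i< → ∑-cong (Y₁ + dY) (λ y _ → inSumset-reflectFst k fst≤ (far≤k sp i<))))
                     (C₁₀.∑-inSumset 0 dY (far sp) (near sq) Q+Q≤k D+Q+Q≤k Q+Q≤k)
    corner₁₁ = trans (∑-cong (X₁ + 0) (λ i i< → ∑-cong (Y₁ + 0) (λ j j< →
                       trans (inSumset-reflectFst k fst≤ (far≤k sp i<))
                             (inSumset-reflectSnd k (Admissible.snd≤ (reflectFst-admissible H)) (far≤k sq j<)))))
                     (C₁₁.∑-inSumset 0 0 (far sp) (far sq) Q+Q≤k Q+Q≤k Q+Q≤k)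

    collect : ∀ c₀₀ c₀₁ c₁₀ c₁₁ g₀₀ g₀₁ g₁₀ g₁₁ h₀₀ h₀₁ h₁₀ h₁₁ dX dY →
      c₀₀ + dY * g₀₀ + dX * h₀₀ + dX * dY + (c₀₁ + 0 * g₀₁ + dX * h₀₁ + dX * 0)
      + (c₁₀ + dY * g₁₀ + 0 * h₁₀ + 0 * dY) + (c₁₁ + 0 * g₁₁ + 0 * h₁₁ + 0 * 0)
      ≡ c₀₀ + c₀₁ + c₁₀ + c₁₁ + dY * (g₀₀ + g₁₀) + dX * (h₀₀ + h₀₁) + dX * dY
    collect = solve-∀

open import Data.Integer using (ℤ; +_; _-_) renaming (_*_ to _*ℤ_)
import Data.Integer as ℤ
open import Data.Integer.Properties using (pos-+; pos-*)
import Data.Integer.Tactic.RingSolver as ℤ-Solver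

pos-count : ∀ D s t c g h →
  + (c + suc (D * t) * g + suc (D * s) * h + suc (D * s) * suc (D * t)) ≡
  + c ℤ.+ (+ 1 ℤ.+ + D *ℤ + t) *ℤ + g ℤ.+ (+ 1 ℤ.+ + D *ℤ + s) *ℤ + h ℤ.+ (+ 1 ℤ.+ + D *ℤ + s) *ℤ (+ 1 ℤ.+ + D *ℤ + t)
pos-count D s t c g h = begin
  + (c + dt * g + ds * h + ds * dt)                ≡⟨ pos-+ (c + dt * g + ds * h) (ds * dt) ⟩
  + (c + dt * g + ds * h) ℤ.+ + (ds * dt)          ≡⟨ cong₂ ℤ._+_ (pos-+ (c + dt * g) (ds * h)) (pos-* ds dt) ⟩
  + (c + dt * g) ℤ.+ + (ds * h) ℤ.+ + ds *ℤ + dt   ≡⟨ cong₂ (λ u w → u ℤ.+ w ℤ.+ + ds *ℤ + dt) (pos-+ c (dt * g)) (pos-* ds h) ⟩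
  + c ℤ.+ + (dt * g) ℤ.+ + ds *ℤ + h ℤ.+ + ds *ℤ + dt
                                                   ≡⟨ cong (λ u → + c ℤ.+ u ℤ.+ + ds *ℤ + h ℤ.+ + ds *ℤ + dt) (pos-* dt g) ⟩
  + c ℤ.+ + dt *ℤ + g ℤ.+ + ds *ℤ + h ℤ.+ + ds *ℤ + dt
                                                   ≡⟨ cong₂ (λ u w → + c ℤ.+ w *ℤ + g ℤ.+ u *ℤ + h ℤ.+ u *ℤ w) (pos-suc s) (pos-suc t) ⟩
  + c ℤ.+ (+ 1 ℤ.+ + D *ℤ + t) *ℤ + g ℤ.+ (+ 1 ℤ.+ + D *ℤ + s) *ℤ + h ℤ.+ (+ 1 ℤ.+ + D *ℤ + s) *ℤ (+ 1 ℤ.+ + D *ℤ + t) ∎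
  where
  open ≡-Reasoning
  ds dt : ℕ
  ds = suc (D * s)
  dt = suc (D * t)
  pos-suc : ∀ s → + suc (D * s) ≡ + 1 ℤ.+ + D *ℤ + s
  pos-suc s = trans (pos-+ 1 (D * s)) (cong (ℤ._+_ (+ 1)) (pos-* D s))

-- The count of Count.card-sumset≡ as a polynomial in k = D + 2Q: ℓ is minus its value at k = 0,
-- and ℓ₁ s, ℓ₂ t are minus the two parts of its linear coefficient.
expand-around : ∀ (D Q s t c g h : ℤ) →
  c ℤ.+ (+ 1 ℤ.+ D *ℤ t) *ℤ g ℤ.+ (+ 1 ℤ.+ D *ℤ s) *ℤ h ℤ.+ (+ 1 ℤ.+ D *ℤ s) *ℤ (+ 1 ℤ.+ D *ℤ t)
  ≡ (D ℤ.+ (Q ℤ.+ Q)) *ℤ (D ℤ.+ (Q ℤ.+ Q)) *ℤ s *ℤ t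
    - ℤ.- (c ℤ.+ (+ 1 - (Q ℤ.+ Q) *ℤ t) *ℤ g ℤ.+ (+ 1 - (Q ℤ.+ Q) *ℤ s) *ℤ h ℤ.+ (+ 1 - (Q ℤ.+ Q) *ℤ s) *ℤ (+ 1 - (Q ℤ.+ Q) *ℤ t))
    - ((Q ℤ.+ Q) *ℤ t - + 1 - h) *ℤ s *ℤ (D ℤ.+ (Q ℤ.+ Q))
    - ((Q ℤ.+ Q) *ℤ s - + 1 - g) *ℤ t *ℤ (D ℤ.+ (Q ℤ.+ Q))
expand-around = ℤ-Solver.solve-∀

module _ {A p q α β} (H : Admissible A p q α β) where
  open Count H

  card-sumset-polynomial : ∃ λ (ℓ : ℤ) → ∃ λ (ℓ₁ : ℤ) → ∃ λ (ℓ₂ : ℤ) → ∀ k → Q + Q ≤ k →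
    + card-sumset k A ≡ + (k * k * sp * sq) - ℓ - ℓ₁ *ℤ + sp *ℤ + k - ℓ₂ *ℤ + sq *ℤ + k
  card-sumset-polynomial = ℓ , ℓ₁ , ℓ₂ , λ k k≥ → subst Formula (m∸n+n≡m k≥) (formula (k ∸ (Q + Q)))
    where
    2Q : ℤ
    2Q = + Q ℤ.+ + Q
    ℓ ℓ₁ ℓ₂ : ℤ
    ℓ  = ℤ.- (+ c ℤ.+ (+ 1 - 2Q *ℤ + sq) *ℤ + g ℤ.+ (+ 1 - 2Q *ℤ + sp) *ℤ + h ℤ.+ (+ 1 - 2Q *ℤ + sp) *ℤ (+ 1 - 2Q *ℤ + sq))
    ℓ₁ = 2Q *ℤ + sq - + 1 - + h
    ℓ₂ = 2Q *ℤ + sp - + 1 - + g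

    Formula : ℕ → Set
    Formula k = + card-sumset k A ≡ + (k * k * sp * sq) - ℓ - ℓ₁ *ℤ + sp *ℤ + k - ℓ₂ *ℤ + sq *ℤ + k

    formula : ∀ D → Formula (D + (Q + Q))
    formula D = begin
      + card-sumset k A                                         ≡⟨ cong +_ (card-sumset≡ D) ⟩
      + (c + suc (D * sq) * g + suc (D * sp) * h + suc (D * sp) * suc (D * sq))
                                                                ≡⟨ pos-count D sp sq c g h ⟩
      _                                                         ≡⟨ expand-around (+ D) (+ Q) (+ sp) (+ sq) (+ c) (+ g) (+ h) ⟩
      K *ℤ K *ℤ + sp *ℤ + sq - ℓ - ℓ₁ *ℤ + sp *ℤ K - ℓ₂ *ℤ + sq *ℤ K
                                                                ≡⟨ cong₂ (λ P K' → P - ℓ - ℓ₁ *ℤ + sp *ℤ K' - ℓ₂ *ℤ + sq *ℤ K') pos-k² pos-k ⟨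
      + (k * k * sp * sq) - ℓ - ℓ₁ *ℤ + sp *ℤ + k - ℓ₂ *ℤ + sq *ℤ + k ∎
      where
      open ≡-Reasoning
      k : ℕ
      k = D + (Q + Q)
      K : ℤ
      K = + D ℤ.+ 2Q
      pos-k : + k ≡ K
      pos-k = trans (pos-+ D (Q + Q)) (cong (ℤ._+_ (+ D)) (pos-+ Q Q))
      pos-k² : + (k * k * sp * sq) ≡ K *ℤ K *ℤ + sp *ℤ + sq
      pos-k² = trans (pos-* (k * k * sp) sq) (cong (_*ℤ + sq) (trans (pos-* (k * k) sp)
                 (cong (_*ℤ + sp) (trans (pos-* k k) (cong₂ _*ℤ_ pos-k pos-k)))))

lemma3p8 : (A : List Pt) (a a' b b' : ℕ) →
  -- a is the smallest non-zero first coordinate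
  (∃ λ p → p ∈ A × proj₁ p ≡ a) → NonZero a →
  (∀ p → p ∈ A → NonZero (proj₁ p) → a ≤ proj₁ p) →
  -- a' is the largest first coordinate
  (∃ λ p → p ∈ A × proj₁ p ≡ a') →
  (∀ p → p ∈ A → proj₁ p ≤ a') →
  -- b is the smallest non-zero second coordinate
  (∃ λ p → p ∈ A × proj₂ p ≡ b) → NonZero b →
  (∀ p → p ∈ A → NonZero (proj₂ p) → b ≤ proj₂ p) →
  -- b' is the largest second coordinate
  (∃ λ p → p ∈ A × proj₂ p ≡ b') →
  (∀ p → p ∈ A → proj₂ p ≤ b') →
  Coprime a a' → Coprime b b' →
  (0 , 0) ∈ A → (a , 0) ∈ A → (0 , b) ∈ A → (a' , 0) ∈ A → (0 , b') ∈ A →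
  (a , b) ∈ A → (a , b') ∈ A → (a' , b) ∈ A → (a' , b') ∈ A →
  ∃ λ (ℓ : ℤ) → ∃ λ (ℓ₁ : ℤ) → ∃ λ (ℓ₂ : ℤ) →
    ∀ (k : ℕ) → (2 * (a' * a')) ⊔ (2 * (b' * b')) ≤ k →
      + card-sumset k A ≡
        + (k * k * a' * b') - ℓ - ℓ₁ *ℤ + a' *ℤ + k - ℓ₂ *ℤ + b' *ℤ + k
lemma3p8 A a zero b b' _ a≢0 _ _ a'-max _ _ _ _ _ _ _ _ a0∈ _ _ _ _ _ _ _ =
  contradiction (n≤0⇒n≡0 (a'-max (a , 0) a0∈)) (≢-nonZero⁻¹ a {{a≢0}})
lemma3p8 A a (suc p) b zero _ _ _ _ _ _ b≢0 _ _ b'-max _ _ _ _ 0b∈ _ _ _ _ _ _ =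
  contradiction (n≤0⇒n≡0 (b'-max (0 , b) 0b∈)) (≢-nonZero⁻¹ b {{b≢0}})
lemma3p8 A a (suc p) b (suc q) _ _ _ _ a'-max _ _ _ _ b'-max a-coprime b-coprime
         00∈ a0∈ 0b∈ a'0∈ 0b'∈ ab∈ ab'∈ a'b∈ a'b'∈ =
  let ℓ , ℓ₁ , ℓ₂ , formula = card-sumset-polynomial H
  in  ℓ , ℓ₁ , ℓ₂ , λ k k≥ → formula k (≤-trans (≤-reflexive 2Q≡) k≥)
  where
  H : Admissible A p q a b
  H = record
    { fst≤ = a'-max _ ; snd≤ = b'-max _ ; grid⊆ = grid⊆
    ; α-coprime = a-coprime ; β-coprime = b-coprime
    ; α≤ = a'-max (a , 0) a0∈ ; β≤ = b'-max (0 , b) 0b∈ }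
    where
    grid⊆ : ∀ {u v} → u ∈ grid a (suc p) → v ∈ grid b (suc q) → (u , v) ∈ A
    grid⊆ (here refl)                 (here refl)                 = 00∈
    grid⊆ (here refl)                 (there (here refl))         = 0b∈
    grid⊆ (here refl)                 (there (there (here refl))) = 0b'∈
    grid⊆ (there (here refl))         (here refl)                 = a0∈
    grid⊆ (there (here refl))         (there (here refl))         = ab∈
    grid⊆ (there (here refl))         (there (there (here refl))) = ab'∈
    grid⊆ (there (there (here refl))) (here refl)                 = a'0∈
    grid⊆ (there (there (here refl))) (there (here refl))         = a'b∈
    grid⊆ (there (there (here refl))) (there (there (here refl))) = a'b'∈
  2Q≡ : Count.Q H + Count.Q H ≡ 2 * (suc p * suc p) ⊔ 2 * (suc q * suc q)
  2Q≡ = trans (cong (_+_ (Count.Q H)) (sym (+-identityʳ (Count.Q H)))) (*-distribˡ-⊔ 2 (suc p * suc p) (suc q * suc q))
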